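{- Let $A$ be the bipartite adjacency matrix of a cubic Lehman graph with $k=1$, and let $B$ be the $(0,1)$-matrix with $AB^T=J+I$. Let $b_1\neq b_2$ be black vertices and $w$ a white vertex with $A(b_1,w)=A(b_2,w)=1$. Then for every white vertex $w'\neq w$, either $B(b_1,w')=0$ or $B(b_2,w')=0$.
   Context: A bipartite graph with $n$ black and $n$ white vertices has bipartite adjacency matrix $A$ (rows indexed by black vertices, columns by white vertices, entry $1$ iff adjacent). It is a cubic Lehman graph with $k=1$ if it is $3$-regular and there exists an $n\times n$ $(0,1)$-matrix $B$ with $AB^T=J+I$, where $J$ is the all-ones matrix and $I$ the identity. -}

module Defs where

open import Data.Nat using (ℕ; zero; suc; _+_; _*_)
open import Data.Fin using (Fin; zero; suc; _≟_)
open import Data.Product using (_×_)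
open import Relation.Nullary using (yes; no)
open import Data.Sum using (_⊎_)
open import Relation.Binary.PropositionalEquality using (_≡_)

-- n × n matrices with natural-number entries (rows: black, columns: white)
Matrix : ℕ → Set
Matrix n = Fin n → Fin n → ℕ

Σ[<_] : (n : ℕ) → (Fin n → ℕ) → ℕ
Σ[< zero ] f = 0
Σ[< suc n ] f = f zero + Σ[< n ] (λ i → f (suc i))

Is01 : ∀ {n} → Matrix n → Set
Is01 {n} M = ∀ (i j : Fin n) → M i j ≡ 0 ⊎ M i j ≡ 1

Cubic : ∀ {n} → Matrix n → Set
Cubic {n} A = (∀ i → Σ[< n ] (λ j → A i j) ≡ 3) × (∀ j → Σ[< n ] (λ i → A i j) ≡ 3)

δ : ∀ {n} → Fin n → Fin n → ℕ
δ i j with i ≟ j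
... | yes _ = 1
... | no _ = 0

ABᵀ : ∀ {n} → Matrix n → Matrix n → Matrix n
ABᵀ {n} A B i j = Σ[< n ] (λ w → A i w * B j w)

ABᵀ≡J+I : ∀ {n} → Matrix n → Matrix n → Set
ABᵀ≡J+I A B = ∀ i j → ABᵀ A B i j ≡ 1 + δ i j

-- Over ℚ the matrix J + I is invertible, so A Bᵀ = J + I makes the square matrix A
-- invertible; we avoid fractions by using instead that any n + 1 integer vectors of
-- length n are linearly dependent. Since A has constant row and column sums, A commutes
-- with J, hence A (Bᵀ A) = (J + I) A = A (J + I) and so Bᵀ A = J + I as well. Its entry
-- at (w′, w) for w′ ≠ w is Σ_b B(b,w′) A(b,w) = 1, which two black neighbours b₁, b₂
-- of w with B(b₁,w′) = B(b₂,w′) = 1 would push up to at least 2.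
module Submission where

open import Defs
open import Data.Nat using (ℕ)
open import Data.Fin using (Fin)
open import Data.Sum using (_⊎_)
open import Relation.Binary.PropositionalEquality using (_≡_; _≢_)

open import Data.Nat as ℕ using (zero; suc; _≤_)
import Data.Nat.Properties as ℕ
open import Data.Integer using (ℤ; +_; -_; 0ℤ; 1ℤ; -1ℤ; _+_; _*_; _-_)
import Data.Integer.Properties as ℤ
open import Data.Integer.Tactic.RingSolver using (solve-∀)
open import Data.Fin as Fin using (zero; suc; punchIn)
import Data.Fin.Properties as Fin
open import Data.Vec.Functional using (insertAt; _∷_)
import Data.Vec.Functional.Properties as Vec
open import Data.Product using (_,_)
open import Data.Sum using (inj₁; inj₂; [_,_]′; fromInj₁; fromInj₂)
open import Data.Empty using (⊥-elim)
open import Function using (_∘_)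
open import Relation.Nullary using (yes; no; ¬?)
open import Relation.Nullary.Decidable using (decidable-stable)
open import Relation.Binary.PropositionalEquality
  using (refl; sym; trans; cong; cong₂; subst; _≗_; module ≡-Reasoning)
import Algebra.Properties.Semiring.Sum ℤ.+-*-semiring as Sum
open Sum using (sum; sum-cong-≗; ∑-distrib-+; ∑-comm; sum-remove; *-distribˡ-sum; *-distribʳ-sum)

sum-neg : ∀ {n} (f : Fin n → ℤ) → sum (λ i → - f i) ≡ - sum f
sum-neg f = begin
  sum (λ i → - f i)     ≡⟨ sum-cong-≗ (λ i → sym (ℤ.-1*i≡-i (f i))) ⟩
  sum (λ i → -1ℤ * f i) ≡⟨ sym (*-distribˡ-sum -1ℤ f) ⟩
  -1ℤ * sum f           ≡⟨ ℤ.-1*i≡-i (sum f) ⟩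
  - sum f               ∎
  where open ≡-Reasoning

sum-sub : ∀ {n} (f g : Fin n → ℤ) → sum (λ i → f i - g i) ≡ sum f - sum g
sum-sub f g = trans (∑-distrib-+ f (λ i → - g i)) (cong (_+_ (sum f)) (sum-neg g))

sum-zero : ∀ {n} (f : Fin n → ℤ) → (∀ i → f i ≡ 0ℤ) → sum f ≡ 0ℤ
sum-zero {n} f f≗0 = trans (sum-cong-≗ f≗0) (Sum.sum-replicate-zero n)

sum-const : ∀ n x → sum {n} (λ _ → x) ≡ + n * x
sum-const zero    x = sym (ℤ.*-zeroˡ x)
sum-const (suc n) x = trans (cong (_+_ x) (sum-const n x)) (suc*x (+ n) x)
  where
  suc*x : ∀ m x → x + m * x ≡ (1ℤ + m) * x
  suc*x = solve-∀

δ-refl : ∀ {n} (i : Fin n) → δ i i ≡ 1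
δ-refl i with i Fin.≟ i
... | yes _   = refl
... | no i≢i = ⊥-elim (i≢i refl)

δ-≢ : ∀ {n} {i j : Fin n} → i ≢ j → δ i j ≡ 0
δ-≢ {i = i} {j} i≢j with i Fin.≟ j
... | yes i≡j = ⊥-elim (i≢j i≡j)
... | no _    = refl

sum-δ* : ∀ {n} (α : Fin n → ℤ) i → sum (λ j → + δ i j * α j) ≡ α i
sum-δ* {suc n} α i = begin
  sum (λ j → + δ i j * α j)
    ≡⟨ sum-remove (λ j → + δ i j * α j) ⟩
  + δ i i * α i + sum (λ j → + δ i (punchIn i j) * α (punchIn i j))
    ≡⟨ cong₂ _+_ (cong (λ d → + d * α i) (δ-refl i)) (sum-zero _ off-diagonal) ⟩
  1ℤ * α i + 0ℤ
    ≡⟨ trans (ℤ.+-identityʳ _) (ℤ.*-identityˡ (α i)) ⟩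
  α i ∎
  where
  open ≡-Reasoning
  off-diagonal : ∀ j → + δ i (punchIn i j) * α (punchIn i j) ≡ 0ℤ
  off-diagonal j = cong (λ d → + d * α (punchIn i j)) (δ-≢ (Fin.punchInᵢ≢i i j ∘ sym))

+-Σ[<] : ∀ {n} (f : Fin n → ℕ) → + Σ[< n ] f ≡ sum (+_ ∘ f)
+-Σ[<] {zero}  f = refl
+-Σ[<] {suc n} f = trans (ℤ.pos-+ (f zero) _) (cong (_+_ (+ f zero)) (+-Σ[<] (f ∘ suc)))

combination : ∀ {m n} → (Fin m → ℤ) → (Fin m → Fin n → ℤ) → Fin n → ℤ
combination α v k = sum (λ i → v i k * α i)

infixr 7 _⊙_
_⊙_ : ∀ {m n} → (Fin m → Fin n → ℤ) → (Fin n → ℤ) → Fin m → ℤ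
(M ⊙ x) i = sum (λ k → M i k * x k)

⊙-combination : ∀ {l m n} (M : Fin l → Fin n → ℤ) (α : Fin m → ℤ) (v : Fin m → Fin n → ℤ) →
                M ⊙ combination α v ≗ combination α (λ i → M ⊙ v i)
⊙-combination M α v b = begin
  sum (λ k → M b k * sum (λ i → v i k * α i))
    ≡⟨ sum-cong-≗ (λ k → trans (*-distribˡ-sum (M b k) (λ i → v i k * α i))
                               (sum-cong-≗ (λ i → sym (ℤ.*-assoc (M b k) (v i k) (α i))))) ⟩
  sum (λ k → sum (λ i → M b k * v i k * α i))
    ≡⟨ ∑-comm (λ k i → M b k * v i k * α i) ⟩
  sum (λ i → sum (λ k → M b k * v i k * α i))
    ≡⟨ sum-cong-≗ (λ i → sym (*-distribʳ-sum (α i) (λ k → M b k * v i k))) ⟩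
  sum (λ i → (M ⊙ v i) b * α i) ∎
  where open ≡-Reasoning

⊙-sub : ∀ {m n} (M : Fin m → Fin n → ℤ) (x y : Fin n → ℤ) → M ⊙ (λ k → x k - y k) ≗ λ i → (M ⊙ x) i - (M ⊙ y) i
⊙-sub M x y i = trans (sum-cong-≗ (λ k → distrib (M i k) (x k) (y k))) (sum-sub (λ k → M i k * x k) (λ k → M i k * y k))
  where
  distrib : ∀ a b c → a * (b - c) ≡ a * b - a * c
  distrib = solve-∀

J+I : ∀ {n} → Fin n → Fin n → ℤ
J+I i j = 1ℤ + + δ i j

J+I-⊙ : ∀ {n} (α : Fin n → ℤ) → J+I ⊙ α ≗ λ i → sum α + α i
J+I-⊙ α i = begin
  sum (λ j → (1ℤ + + δ i j) * α j)
    ≡⟨ sum-cong-≗ (λ j → trans (ℤ.*-distribʳ-+ (α j) 1ℤ (+ δ i j)) (cong (_+ + δ i j * α j) (ℤ.*-identityˡ (α j)))) ⟩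
  sum (λ j → α j + + δ i j * α j)
    ≡⟨ ∑-distrib-+ α (λ j → + δ i j * α j) ⟩
  sum α + sum (λ j → + δ i j * α j)
    ≡⟨ cong (_+_ (sum α)) (sum-δ* α i) ⟩
  sum α + α i ∎
  where open ≡-Reasoning

record LinearDependence {m n} (v : Fin m → Fin n → ℤ) : Set where
  field
    coefficients : Fin m → ℤ
    support      : Fin m
    nonzero      : coefficients support ≢ 0ℤ
    vanishes     : ∀ k → combination coefficients v k ≡ 0ℤ

dependence-of-tails : ∀ {m n} (v : Fin (suc m) → Fin (suc n) → ℤ) → (∀ i → v i zero ≡ 0ℤ) →
                      LinearDependence (λ i k → v (suc i) (suc k)) → LinearDependence v
dependence-of-tails v heads≡0 dep = record
  { coefficients = 0ℤ ∷ coefficients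
  ; support      = suc support
  ; nonzero      = nonzero
  ; vanishes     = λ where
      zero    → cong₂ _+_ (ℤ.*-zeroʳ (v zero zero))
                          (sum-zero _ λ i → trans (cong (_* coefficients i) (heads≡0 (suc i)))
                                                  (ℤ.*-zeroˡ (coefficients i)))
      (suc k) → cong₂ _+_ (ℤ.*-zeroʳ (v zero (suc k))) (vanishes k)
  }
  where open LinearDependence dep

-- Gaussian elimination of the first coordinate against the pivot v i₀: a dependence β
-- among the eliminated vectors lifts to v with coefficient p βⱼ on v (punchIn i₀ j)
-- and −Σⱼ βⱼ u j 0 on v i₀.
module Elimination {m n} (v : Fin (suc m) → Fin (suc n) → ℤ) (i₀ : Fin (suc m)) where

  private
    p : ℤ
    p = v i₀ zero
    u : Fin m → Fin (suc n) → ℤ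
    u j = v (punchIn i₀ j)

  eliminated : Fin m → Fin n → ℤ
  eliminated j k = p * u j (suc k) - u j zero * v i₀ (suc k)

  dependence-by-elimination : p ≢ 0ℤ → LinearDependence eliminated → LinearDependence v
  dependence-by-elimination p≢0 dep = record
    { coefficients = α
    ; support      = punchIn i₀ support
    ; nonzero      = α-nonzero
    ; vanishes     = λ where
        zero    → trans (split zero) (cancel S p)
        (suc k) → trans (split (suc k)) (trans (reorder S (v i₀ (suc k)) _)
                    (trans (sym (eliminated-combination k)) (vanishes k)))
    }
    where
    open LinearDependence dep renaming (coefficients to β)
    cancel : ∀ S p → p * - S + p * S ≡ 0ℤ
    cancel = solve-∀
    reorder : ∀ S c X → c * - S + X ≡ X - S * c
    reorder = solve-∀
    swap : ∀ a p b → a * (p * b) ≡ p * (a * b)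
    swap = solve-∀
    S : ℤ
    S = combination β u zero
    α : Fin (suc m) → ℤ
    α = insertAt (λ j → p * β j) i₀ (- S)

    α-nonzero : α (punchIn i₀ support) ≢ 0ℤ
    α-nonzero α≡0 = [ p≢0 , nonzero ]′
      (ℤ.i*j≡0⇒i≡0∨j≡0 p (trans (sym (Vec.insertAt-punchIn (λ j → p * β j) i₀ (- S) support)) α≡0))

    split : ∀ k → combination α v k ≡ v i₀ k * - S + p * combination β u k
    split k = begin
      combination α v k
        ≡⟨ sum-remove (λ i → v i k * α i) ⟩
      v i₀ k * α i₀ + sum (λ j → u j k * α (punchIn i₀ j))
        ≡⟨ cong₂ _+_ (cong (v i₀ k *_) (Vec.insertAt-lookup (λ j → p * β j) i₀ (- S)))
                     (sum-cong-≗ λ j → trans (cong (u j k *_) (Vec.insertAt-punchIn (λ j → p * β j) i₀ (- S) j))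
                                             (swap (u j k) p (β j))) ⟩
      v i₀ k * - S + sum (λ j → p * (u j k * β j))
        ≡⟨ cong (_+_ (v i₀ k * - S)) (sym (*-distribˡ-sum p (λ j → u j k * β j))) ⟩
      v i₀ k * - S + p * combination β u k ∎
      where open ≡-Reasoning

    eliminated-combination : ∀ k → combination β eliminated k ≡ p * combination β u (suc k) - S * v i₀ (suc k)
    eliminated-combination k = begin
      sum (λ j → (p * u j (suc k) - u j zero * c) * β j)
        ≡⟨ sum-cong-≗ (λ j → expand p (u j (suc k)) (u j zero) c (β j)) ⟩
      sum (λ j → p * (u j (suc k) * β j) - u j zero * β j * c)
        ≡⟨ sum-sub (λ j → p * (u j (suc k) * β j)) (λ j → u j zero * β j * c) ⟩
      sum (λ j → p * (u j (suc k) * β j)) - sum (λ j → u j zero * β j * c)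
        ≡⟨ cong₂ _-_ (sym (*-distribˡ-sum p (λ j → u j (suc k) * β j)))
                     (sym (*-distribʳ-sum c (λ j → u j zero * β j))) ⟩
      p * combination β u (suc k) - S * c ∎
      where
      open ≡-Reasoning
      c = v i₀ (suc k)
      expand : ∀ p a b c x → (p * a - b * c) * x ≡ p * (a * x) - b * x * c
      expand = solve-∀

open Elimination using (eliminated; dependence-by-elimination)

linearDependence : ∀ n (v : Fin (suc n) → Fin n → ℤ) → LinearDependence v
linearDependence zero    v = record { coefficients = λ _ → 1ℤ ; support = zero ; nonzero = λ () ; vanishes = λ () }
linearDependence (suc n) v with Fin.any? (λ i → ¬? (v i zero ℤ.≟ 0ℤ))
... | yes (i₀ , p≢0) = dependence-by-elimination v i₀ p≢0 (linearDependence n (eliminated v i₀))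
... | no no-pivot    = dependence-of-tails v heads≡0 (linearDependence n (λ i k → v (suc i) (suc k)))
  where
  heads≡0 : ∀ i → v i zero ≡ 0ℤ
  heads≡0 i = decidable-stable (v i zero ℤ.≟ 0ℤ) (λ head≢0 → no-pivot (i , head≢0))

J+I-injective : ∀ {n} (α : Fin n → ℤ) → J+I ⊙ α ≗ (λ _ → 0ℤ) → α ≗ (λ _ → 0ℤ)
J+I-injective {n} α J+Iα≡0 i = begin
  α i           ≡⟨ sym (ℤ.+-identityˡ (α i)) ⟩
  0ℤ + α i      ≡⟨ cong (_+ α i) (sym sum≡0) ⟩
  sum α + α i   ≡⟨ sym (J+I-⊙ α i) ⟩
  (J+I ⊙ α) i   ≡⟨ J+Iα≡0 i ⟩
  0ℤ            ∎
  where
  open ≡-Reasoning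
  [1+n]sum : ∀ m S → (1ℤ + m) * S ≡ m * S + S
  [1+n]sum = solve-∀
  [1+n]sum≡0 : + suc n * sum α ≡ 0ℤ
  [1+n]sum≡0 = begin
    + suc n * sum α                 ≡⟨ [1+n]sum (+ n) (sum α) ⟩
    + n * sum α + sum α             ≡⟨ cong (_+ sum α) (sym (sum-const n (sum α))) ⟩
    sum {n} (λ _ → sum α) + sum α   ≡⟨ sym (∑-distrib-+ (λ _ → sum α) α) ⟩
    sum (λ i → sum α + α i)         ≡⟨ sum-zero (λ i → sum α + α i) (λ i → trans (sym (J+I-⊙ α i)) (J+Iα≡0 i)) ⟩
    0ℤ                              ∎
  sum≡0 : sum α ≡ 0ℤ
  sum≡0 = fromInj₂ (λ ()) (ℤ.i*j≡0⇒i≡0∨j≡0 (+ suc n) [1+n]sum≡0)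

-- Take a dependence among the n + 1 vectors x, B 0, …, B (n − 1). Applying A kills x and
-- leaves J + I applied to the coefficients of the B j, so those vanish and that of x cannot.
⊙-kernel-trivial : ∀ {n} (A B : Fin n → Fin n → ℤ) → (∀ j → A ⊙ B j ≗ λ i → J+I i j) →
                   (x : Fin n → ℤ) → A ⊙ x ≗ (λ _ → 0ℤ) → x ≗ (λ _ → 0ℤ)
⊙-kernel-trivial {n} A B ABᵀ≡J+I x Ax≡0 k = fromInj₁ (⊥-elim ∘ α₀≢0) (ℤ.i*j≡0⇒i≡0∨j≡0 (x k) xₖα₀≡0)
  where
  open LinearDependence (linearDependence n (x ∷ B))
  α₀ : ℤ
  α₀ = coefficients zero
  α′ : Fin n → ℤ
  α′ = coefficients ∘ suc
  J+Iα′≡0 : J+I ⊙ α′ ≗ (λ _ → 0ℤ)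
  J+Iα′≡0 b = begin
    (J+I ⊙ α′) b                                 ≡⟨ sum-cong-≗ (λ j → cong (_* α′ j) (sym (ABᵀ≡J+I j b))) ⟩
    sum (λ j → (A ⊙ B j) b * α′ j)               ≡⟨ sym (ℤ.+-identityˡ _) ⟩
    0ℤ * α₀ + sum (λ j → (A ⊙ B j) b * α′ j)     ≡⟨ cong (λ y → y * α₀ + sum (λ j → (A ⊙ B j) b * α′ j)) (sym (Ax≡0 b)) ⟩
    combination coefficients (λ i → A ⊙ (x ∷ B) i) b ≡⟨ sym (⊙-combination A coefficients (x ∷ B) b) ⟩
    (A ⊙ combination coefficients (x ∷ B)) b     ≡⟨ sum-zero (λ k → A b k * combination coefficients (x ∷ B) k)
                                                               (λ k → trans (cong (A b k *_) (vanishes k)) (ℤ.*-zeroʳ (A b k))) ⟩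
    0ℤ                                           ∎
    where open ≡-Reasoning
  α′≡0 : α′ ≗ (λ _ → 0ℤ)
  α′≡0 = J+I-injective α′ J+Iα′≡0
  rows≡0 : sum (λ j → B j k * α′ j) ≡ 0ℤ
  rows≡0 = sum-zero (λ j → B j k * α′ j) (λ j → trans (cong (B j k *_) (α′≡0 j)) (ℤ.*-zeroʳ (B j k)))
  α₀≢0 : α₀ ≢ 0ℤ
  α₀≢0 with support | nonzero
  ... | zero  | α≢0 = α≢0
  ... | suc j | α≢0 = λ _ → α≢0 (α′≡0 j)
  xₖα₀≡0 : x k * α₀ ≡ 0ℤ
  xₖα₀≡0 = trans (sym (ℤ.+-identityʳ _)) (trans (cong (_+_ (x k * α₀)) (sym rows≡0)) (vanishes k))

⊙-injective : ∀ {n} (A B : Fin n → Fin n → ℤ) → (∀ j → A ⊙ B j ≗ λ i → J+I i j) →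
              (x y : Fin n → ℤ) → A ⊙ x ≗ A ⊙ y → x ≗ y
⊙-injective A B ABᵀ≡J+I x y Ax≡Ay k =
  ℤ.i-j≡0⇒i≡j (x k) (y k) (⊙-kernel-trivial A B ABᵀ≡J+I (λ k → x k - y k) A[x-y]≡0 k)
  where
  A[x-y]≡0 : A ⊙ (λ k → x k - y k) ≗ (λ _ → 0ℤ)
  A[x-y]≡0 i = trans (⊙-sub A x y i) (trans (cong (_- (A ⊙ y) i) (Ax≡Ay i)) (ℤ.+-inverseʳ ((A ⊙ y) i)))

+-Σ[<]-* : ∀ {n} (f g : Fin n → ℕ) → + Σ[< n ] (λ i → f i ℕ.* g i) ≡ sum (λ i → + f i * + g i)
+-Σ[<]-* f g = trans (+-Σ[<] (λ i → f i ℕ.* g i)) (sum-cong-≗ (λ i → ℤ.pos-* (f i) (g i)))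

ABᵀ≡J+I⇒BᵀA≡J+I : ∀ {n} r (A B : Matrix n) →
                  (∀ i → Σ[< n ] (λ j → A i j) ≡ r) → (∀ j → Σ[< n ] (λ i → A i j) ≡ r) →
                  ABᵀ≡J+I A B → ∀ w w′ → Σ[< n ] (λ b → B b w′ ℕ.* A b w) ≡ 1 ℕ.+ δ w w′
ABᵀ≡J+I⇒BᵀA≡J+I {n} r A B rows cols AB≡J+I w w′ =
  ℤ.+-injective (trans (+-Σ[<]-* (λ b → B b w′) (λ b → A b w)) (BᵀA≡J+I w′))
  where
  Aℤ Bℤ : Fin n → Fin n → ℤ
  Aℤ i j = + A i j
  Bℤ i j = + B i j
  AℤBℤᵀ≡J+I : ∀ j → Aℤ ⊙ Bℤ j ≗ λ i → J+I i j
  AℤBℤᵀ≡J+I j i = trans (sym (+-Σ[<]-* (A i) (B j))) (cong +_ (AB≡J+I i j))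
  column : Fin n → ℤ
  column b = Aℤ b w
  sum-column : sum column ≡ + r
  sum-column = trans (sym (+-Σ[<] (λ b → A b w))) (cong +_ (cols w))
  sum-row : ∀ b → sum (Aℤ b) ≡ + r
  sum-row b = trans (sym (+-Σ[<] (A b))) (cong +_ (rows b))
  A[BᵀA]≡A[J+I] : Aℤ ⊙ combination column Bℤ ≗ Aℤ ⊙ (λ k → J+I w k)
  A[BᵀA]≡A[J+I] b = begin
    (Aℤ ⊙ combination column Bℤ) b  ≡⟨ ⊙-combination Aℤ column Bℤ b ⟩
    sum (λ b′ → (Aℤ ⊙ Bℤ b′) b * column b′) ≡⟨ sum-cong-≗ (λ b′ → cong (_* column b′) (AℤBℤᵀ≡J+I b′ b)) ⟩
    (J+I ⊙ column) b                ≡⟨ J+I-⊙ column b ⟩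
    sum column + Aℤ b w             ≡⟨ cong (_+ Aℤ b w) (trans sum-column (sym (sum-row b))) ⟩
    sum (Aℤ b) + Aℤ b w             ≡⟨ sym (J+I-⊙ (Aℤ b) w) ⟩
    (J+I ⊙ Aℤ b) w                  ≡⟨ sum-cong-≗ (λ k → ℤ.*-comm (J+I w k) (Aℤ b k)) ⟩
    (Aℤ ⊙ (λ k → J+I w k)) b        ∎
    where open ≡-Reasoning
  BᵀA≡J+I : combination column Bℤ ≗ λ k → J+I w k
  BᵀA≡J+I = ⊙-injective Aℤ Bℤ AℤBℤᵀ≡J+I _ _ A[BᵀA]≡A[J+I]

f≤Σ[<] : ∀ {n} (f : Fin n → ℕ) i → f i ≤ Σ[< n ] f
f≤Σ[<] f zero    = ℕ.m≤m+n (f zero) _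
f≤Σ[<] f (suc i) = ℕ.≤-trans (f≤Σ[<] (f ∘ suc) i) (ℕ.m≤n+m _ (f zero))

f+f≤Σ[<] : ∀ {n} (f : Fin n → ℕ) {i j} → i ≢ j → f i ℕ.+ f j ≤ Σ[< n ] f
f+f≤Σ[<] f {zero}  {zero}  i≢j = ⊥-elim (i≢j refl)
f+f≤Σ[<] f {zero}  {suc j} i≢j = ℕ.+-monoʳ-≤ (f zero) (f≤Σ[<] (f ∘ suc) j)
f+f≤Σ[<] f {suc i} {zero}  i≢j = ℕ.≤-trans (ℕ.≤-reflexive (ℕ.+-comm (f (suc i)) (f zero)))
                                            (ℕ.+-monoʳ-≤ (f zero) (f≤Σ[<] (f ∘ suc) i))
f+f≤Σ[<] f {suc i} {suc j} i≢j = ℕ.≤-trans (f+f≤Σ[<] (f ∘ suc) (i≢j ∘ cong suc)) (ℕ.m≤n+m _ (f zero))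

lemma3p4 : (n : ℕ) (A B : Matrix n) →
    Is01 A → Cubic A → Is01 B → ABᵀ≡J+I A B →
    (b₁ b₂ w : Fin n) → b₁ ≢ b₂ → A b₁ w ≡ 1 → A b₂ w ≡ 1 →
    (w′ : Fin n) → w′ ≢ w → B b₁ w′ ≡ 0 ⊎ B b₂ w′ ≡ 0
lemma3p4 n A B _ (rows , cols) B01 AB≡J+I b₁ b₂ w b₁≢b₂ A₁≡1 A₂≡1 w′ w′≢w
  with B01 b₁ w′ | B01 b₂ w′
... | inj₁ B₁≡0 | _         = inj₁ B₁≡0
... | inj₂ _    | inj₁ B₂≡0 = inj₂ B₂≡0
... | inj₂ B₁≡1 | inj₂ B₂≡1 = ⊥-elim (ℕ.<-irrefl refl (ℕ.≤-trans 2≤Σf (ℕ.≤-reflexive Σf≡1)))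
  where
  f : Fin n → ℕ
  f b = B b w′ ℕ.* A b w
  Σf≡1 : Σ[< n ] f ≡ 1
  Σf≡1 = trans (ABᵀ≡J+I⇒BᵀA≡J+I 3 A B rows cols AB≡J+I w w′) (cong suc (δ-≢ (w′≢w ∘ sym)))
  2≤Σf : 2 ≤ Σ[< n ] f
  2≤Σf = subst (_≤ Σ[< n ] f) (cong₂ ℕ._+_ (cong₂ ℕ._*_ B₁≡1 A₁≡1) (cong₂ ℕ._*_ B₂≡1 A₂≡1))
               (f+f≤Σ[<] f b₁≢b₂)
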